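{- If $H$ is a connected graph of order at least $4$, then $K_3 \,\square\, H$ is not well-dominated.
   Context: All graphs are finite, simple and undirected. $\gamma(X)$ is the minimum size of a dominating set (a set $D$ with every vertex in $D$ or adjacent to a vertex of $D$), $\Gamma(X)$ the maximum size of an inclusion-minimal dominating set; $X$ is well-dominated if $\gamma(X)=\Gamma(X)$. The Cartesian product $G\,\square\, H$ has vertex set $V(G)\times V(H)$, with $(g_1,h_1)\sim(g_2,h_2)$ iff either $g_1=g_2$ and $h_1h_2\in E(H)$, or $h_1=h_2$ and $g_1g_2\in E(G)$. $K_3$ is the complete graph on $3$ vertices. -}

module Defs where

open import Data.Nat using (ℕ; suc; _*_; _≤_; _≥_)
open import Data.Fin using (Fin; remQuot; _≟_)
open import Data.Fin.Subset using (Subset; _∈_; _⊂_; ∣_∣)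
open import Data.Bool using (Bool; true; false; not; _∧_; _∨_)
open import Data.Product using (Σ; ∃; _×_; _,_; proj₁; proj₂)
open import Data.Sum using (_⊎_)
open import Relation.Nullary using (¬_)
open import Relation.Nullary.Decidable using (⌊_⌋)
open import Relation.Binary.PropositionalEquality using (_≡_)

record Graph (n : ℕ) : Set where
  field
    edge   : Fin n → Fin n → Bool
    sym    : ∀ u v → edge u v ≡ edge v u
    irrefl : ∀ v → edge v v ≡ false
open Graph public

_∼[_]_ : ∀ {n} → Fin n → Graph n → Fin n → Set
u ∼[ G ] v = edge G u v ≡ true

data Walk {n} (G : Graph n) : Fin n → Fin n → Set where
  here : ∀ {v} → Walk G v v
  step : ∀ {u w v} → u ∼[ G ] w → Walk G w v → Walk G u v

Connected : ∀ {n} → Graph n → Set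
Connected {n} G = (u v : Fin n) → Walk G u v

K₃ : Graph 3
K₃ = record
  { edge = λ i j → not ⌊ i ≟ j ⌋
  ; sym = symK
  ; irrefl = irrK }
  where
  open import Data.Fin using (zero; suc)
  open import Relation.Binary.PropositionalEquality using (refl)
  symK : ∀ (i j : Fin 3) → not ⌊ i ≟ j ⌋ ≡ not ⌊ j ≟ i ⌋
  symK zero zero = refl
  symK zero (suc zero) = refl
  symK zero (suc (suc zero)) = refl
  symK (suc zero) zero = refl
  symK (suc zero) (suc zero) = refl
  symK (suc zero) (suc (suc zero)) = refl
  symK (suc (suc zero)) zero = refl
  symK (suc (suc zero)) (suc zero) = refl
  symK (suc (suc zero)) (suc (suc zero)) = refl
  irrK : ∀ (i : Fin 3) → not ⌊ i ≟ i ⌋ ≡ false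
  irrK zero = refl
  irrK (suc zero) = refl
  irrK (suc (suc zero)) = refl

-- Cartesian product G □ H on Fin (m * n), where a vertex k stands for the
-- pair remQuot n k : Fin m × Fin n (a bijection, inverse `combine`).
□-edge : ∀ {m n} → Graph m → Graph n → Fin m × Fin n → Fin m × Fin n → Bool
□-edge G H (g₁ , h₁) (g₂ , h₂) =
  (⌊ g₁ ≟ g₂ ⌋ ∧ edge H h₁ h₂) ∨ (⌊ h₁ ≟ h₂ ⌋ ∧ edge G g₁ g₂)

_□_ : ∀ {m n} → Graph m → Graph n → Graph (m * n)
_□_ {m} {n} G H = record
  { edge = λ k l → □-edge G H (remQuot n k) (remQuot n l)
  ; sym = λ k l → symP (remQuot n k) (remQuot n l)
  ; irrefl = λ k → irrP (remQuot n k) }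
  where
  open import Relation.Binary.PropositionalEquality using (refl; cong₂; trans)
  open import Relation.Nullary using (yes; no)
  open import Data.Bool.Properties using (∨-comm)
  dsym : ∀ {k} (a b : Fin k) → ⌊ a ≟ b ⌋ ≡ ⌊ b ≟ a ⌋
  dsym a b with a ≟ b | b ≟ a
  ... | yes _ | yes _ = refl
  ... | no _ | no _ = refl
  ... | yes p | no q = Data.Empty.⊥-elim (q (Relation.Binary.PropositionalEquality.sym p))
    where import Data.Empty
  ... | no p | yes q = Data.Empty.⊥-elim (p (Relation.Binary.PropositionalEquality.sym q))
    where import Data.Empty
  symP : ∀ x y → □-edge G H x y ≡ □-edge G H y x
  symP (g₁ , h₁) (g₂ , h₂) =
    cong₂ _∨_ (cong₂ _∧_ (dsym g₁ g₂) (Graph.sym H h₁ h₂))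
              (cong₂ _∧_ (dsym h₁ h₂) (Graph.sym G g₁ g₂))
  drefl : ∀ {k} (a : Fin k) → ⌊ a ≟ a ⌋ ≡ true
  drefl a with a ≟ a
  ... | yes _ = refl
  ... | no p = Data.Empty.⊥-elim (p refl)
    where import Data.Empty
  irrP : ∀ x → □-edge G H x x ≡ false
  irrP (g , h) rewrite drefl g | drefl h | Graph.irrefl H h | Graph.irrefl G g = refl

Dominating : ∀ {n} → Graph n → Subset n → Set
Dominating {n} G D = (v : Fin n) → v ∈ D ⊎ (∃ λ u → u ∈ D × u ∼[ G ] v)

MinimalDominating : ∀ {n} → Graph n → Subset n → Set
MinimalDominating {n} G D = Dominating G D × ((D' : Subset n) → D' ⊂ D → ¬ Dominating G D')

IsDominationNumber : ∀ {n} → Graph n → ℕ → Set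
IsDominationNumber {n} G k =
  (∃ λ D → Dominating G D × ∣ D ∣ ≡ k) × ((D : Subset n) → Dominating G D → k ≤ ∣ D ∣)

IsUpperDominationNumber : ∀ {n} → Graph n → ℕ → Set
IsUpperDominationNumber {n} G k =
  (∃ λ D → MinimalDominating G D × ∣ D ∣ ≡ k) × ((D : Subset n) → MinimalDominating G D → ∣ D ∣ ≤ k)

WellDominated : ∀ {n} → Graph n → Set
WellDominated G = ∃ λ k → IsDominationNumber G k × IsUpperDominationNumber G k

-- The first copy {0} × V(H) of H is a minimal dominating set of K₃ □ H of size n, since
-- (0, h) is the only member dominating (1, h); so γ ≤ n ≤ Γ. If some y ∈ V(H) and a set R of
-- at least three vertices are such that every r ∈ R ∖ {y} is adjacent to y and to a vertex
-- outside R, then trading R in copy 0 for y in copies 1 and 2 still dominates, so γ < n.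
-- A vertex y of degree ≥ 3 (with R = N(y)) or a path x – y – z whose ends have neighbours
-- outside it (with R = {x, y, z}) supplies such a trade. In the remaining case H has maximum
-- degree 2, and growing a path along leaving edges forces H to be the induced path a – b – c – d;
-- there V(K₃) × {a, d} is a minimal dominating set of size 6 > 4 = n, so Γ > n.

module Submission where

open import Defs hiding (sym)
open import Data.Nat using (ℕ; zero; suc; _+_; _*_; _∸_; _≤_; _<_; _≥_; z≤n; s≤s; _≤?_)
open import Data.Nat.Properties
  using (≤-refl; ≤-reflexive; ≤-trans; <-≤-trans; ≤-<-trans; <⇒≱; ≰⇒>; n≤1+n; +-suc; +-identityʳ;
         +-monoʳ-≤; +-mono-≤; +-monoʳ-<; m∸n+n≡m; module ≤-Reasoning)
open import Data.Fin using (Fin; zero; suc; combine; fromℕ<; _≟_)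
open import Data.Fin.Patterns using (0F; 1F)
open import Data.Fin.Properties
  using (remQuot-combine; combine-injective; combine-surjective; any?; all?; ¬∀⟶∃¬)
open import Data.Fin.Subset using (Subset; inside; outside; _∈_; _∉_; _⊆_; _⊂_; ∣_∣; ⊤; ⁅_⁆; _∪_; ∁; _-_)
  renaming (⊥ to ∅)
open import Data.Fin.Subset.Properties
  using (_∈?_; nonempty?; ∈⊤; ∉⊥; x∈⁅x⁆; x∈⁅y⁆⇒x≡y; x∈p∪q⁺; x∈p∪q⁻; x∈p∧x≢y⇒x∈p-y; x∈∁p⇒x∉p;
         x∉∁p⇒x∈p; x∉p⇒x∈∁p; p⊆q⇒∣p∣≤∣q∣; x∈p⇒∣p-x∣<∣p∣; ∣⊤∣≡n; ∣⊥∣≡0; ∣⁅x⁆∣≡1; ∣∁p∣≡n∸∣p∣; ∣p∣≤n)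
open import Data.Vec using ([]; _∷_; _++_; concat; tabulate; lookup; sum)
open import Data.Vec.Properties using (lookup-concat; lookup∘tabulate; []=⇒lookup; lookup⇒[]=)
open import Data.List using (List; []; _∷_; length)
open import Data.List.Relation.Unary.Any using (here; there)
open import Data.List.Relation.Unary.All using (All; []; _∷_)
import Data.List.Relation.Unary.All as All
open import Data.List.Relation.Unary.All.Properties using (All¬⇒¬Any)
open import Data.List.Relation.Unary.Unique.Propositional using (Unique; []; _∷_)
open import Data.List.Membership.Propositional using () renaming (_∈_ to _∈ₗ_; _∉_ to _∉ₗ_)
open import Data.List.Membership.Propositional.Properties using (∈-++⁺ˡ)
open import Data.Bool using (true; false)
open import Data.Bool.Properties using (∨-zeroʳ)
open import Data.Product using (∃; ∃₂; _×_; _,_; proj₁; proj₂)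
open import Data.Sum using (_⊎_; inj₁; inj₂)
open import Data.Empty using (⊥; ⊥-elim)
open import Function using (_∘_; const)
open import Relation.Nullary using (¬_; yes; no; contradiction)
open import Relation.Unary using (Decidable)
open import Relation.Binary.PropositionalEquality
  using (_≡_; _≢_; refl; sym; trans; cong; cong₂; subst; module ≡-Reasoning)

∣p∪q∣≤∣p∣+∣q∣ : ∀ {n} (p q : Subset n) → ∣ p ∪ q ∣ ≤ ∣ p ∣ + ∣ q ∣
∣p∪q∣≤∣p∣+∣q∣ []            []            = z≤n
∣p∪q∣≤∣p∣+∣q∣ (outside ∷ p) (outside ∷ q) = ∣p∪q∣≤∣p∣+∣q∣ p q
∣p∪q∣≤∣p∣+∣q∣ (inside  ∷ p) (outside ∷ q) = s≤s (∣p∪q∣≤∣p∣+∣q∣ p q)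
∣p∪q∣≤∣p∣+∣q∣ (outside ∷ p) (inside  ∷ q) =
  ≤-trans (s≤s (∣p∪q∣≤∣p∣+∣q∣ p q)) (≤-reflexive (sym (+-suc ∣ p ∣ ∣ q ∣)))
∣p∪q∣≤∣p∣+∣q∣ (inside  ∷ p) (inside  ∷ q) =
  s≤s (≤-trans (∣p∪q∣≤∣p∣+∣q∣ p q) (+-monoʳ-≤ ∣ p ∣ (n≤1+n ∣ q ∣)))

∣p++q∣≡∣p∣+∣q∣ : ∀ {m n} (p : Subset m) (q : Subset n) → ∣ p ++ q ∣ ≡ ∣ p ∣ + ∣ q ∣
∣p++q∣≡∣p∣+∣q∣ []            q = refl
∣p++q∣≡∣p∣+∣q∣ (outside ∷ p) q = ∣p++q∣≡∣p∣+∣q∣ p q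
∣p++q∣≡∣p∣+∣q∣ (inside  ∷ p) q = cong suc (∣p++q∣≡∣p∣+∣q∣ p q)

length≤∣p∣ : ∀ {n} {xs : List (Fin n)} {p : Subset n} → Unique xs → All (_∈ p) xs → length xs ≤ ∣ p ∣
length≤∣p∣ [] [] = z≤n
length≤∣p∣ {xs = x ∷ _} {p} (x≢xs ∷ unique) (x∈p ∷ xs⊆p) =
  ≤-trans (s≤s (length≤∣p∣ unique (All.zipWith remove-x (x≢xs , xs⊆p)))) (x∈p⇒∣p-x∣<∣p∣ x∈p)
  where
  remove-x : ∀ {y} → x ≢ y × y ∈ p → y ∈ p - x
  remove-x (x≢y , y∈p) = x∈p∧x≢y⇒x∈p-y y∈p (x≢y ∘ sym)

∃∉ : ∀ {n} (p : Subset n) → ∣ p ∣ < n → ∃ λ x → x ∉ p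
∃∉ {n} p ∣p∣<n with nonempty? (∁ p)
... | yes (x , x∈∁p) = x , x∈∁p⇒x∉p x∈∁p
... | no ∁p-empty = contradiction n≤∣p∣ (<⇒≱ ∣p∣<n)
  where
  ⊤⊆p : ⊤ ⊆ p
  ⊤⊆p {x} _ = x∉∁p⇒x∈p (λ x∈∁p → ∁p-empty (x , x∈∁p))
  n≤∣p∣ : n ≤ ∣ p ∣
  n≤∣p∣ = ≤-trans (≤-reflexive (sym (∣⊤∣≡n n))) (p⊆q⇒∣p∣≤∣q∣ ⊤⊆p)

fromList : ∀ {n} → List (Fin n) → Subset n
fromList []       = ∅
fromList (x ∷ xs) = ⁅ x ⁆ ∪ fromList xs

module _ {n} {x : Fin n} where

  ∈-fromList⁺ : ∀ {xs} → x ∈ₗ xs → x ∈ fromList xs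
  ∈-fromList⁺ (here refl) = x∈p∪q⁺ (inj₁ (x∈⁅x⁆ x))
  ∈-fromList⁺ (there x∈xs) = x∈p∪q⁺ (inj₂ (∈-fromList⁺ x∈xs))

  ∈-fromList⁻ : ∀ xs → x ∈ fromList xs → x ∈ₗ xs
  ∈-fromList⁻ []       x∈⊥ = contradiction x∈⊥ ∉⊥
  ∈-fromList⁻ (y ∷ ys) x∈  with x∈p∪q⁻ ⁅ y ⁆ (fromList ys) x∈
  ... | inj₁ x∈⁅y⁆ = here (x∈⁅y⁆⇒x≡y y x∈⁅y⁆)
  ... | inj₂ x∈ys  = there (∈-fromList⁻ ys x∈ys)

∣fromList∣≤length : ∀ {n} (xs : List (Fin n)) → ∣ fromList xs ∣ ≤ length xs
∣fromList∣≤length {n} [] = ≤-reflexive (∣⊥∣≡0 n)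
∣fromList∣≤length (x ∷ xs) = begin
  ∣ ⁅ x ⁆ ∪ fromList xs ∣      ≤⟨ ∣p∪q∣≤∣p∣+∣q∣ ⁅ x ⁆ (fromList xs) ⟩
  ∣ ⁅ x ⁆ ∣ + ∣ fromList xs ∣  ≡⟨ cong (_+ ∣ fromList xs ∣) (∣⁅x⁆∣≡1 x) ⟩
  suc ∣ fromList xs ∣          ≤⟨ s≤s (∣fromList∣≤length xs) ⟩
  suc (length xs)              ∎
  where open ≤-Reasoning

length≤∣fromList∣ : ∀ {n} {xs : List (Fin n)} → Unique xs → length xs ≤ ∣ fromList xs ∣
length≤∣fromList∣ unique = length≤∣p∣ unique (All.tabulate ∈-fromList⁺)

neighbourhood : ∀ {n} → Graph n → Fin n → Subset n
neighbourhood G y = tabulate (λ x → edge G x y)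

degree : ∀ {n} → Graph n → Fin n → ℕ
degree G y = ∣ neighbourhood G y ∣

module GraphProperties {n} (G : Graph n) where

  ∼-sym : ∀ {u v} → u ∼[ G ] v → v ∼[ G ] u
  ∼-sym {u} {v} u∼v = trans (Graph.sym G v u) u∼v

  ∼⇒≢ : ∀ {u v} → u ∼[ G ] v → u ≢ v
  ∼⇒≢ {u} u∼u refl with trans (sym u∼u) (irrefl G u)
  ... | ()

  walk-leaves : ∀ {P : Fin n → Set} {u v} → Decidable P → Walk G u v → P u → ¬ P v →
                ∃₂ λ s t → P s × ¬ P t × s ∼[ G ] t
  walk-leaves P? here Pu ¬Pv = contradiction Pu ¬Pv
  walk-leaves P? (step {w = w} u∼w walk) Pu ¬Pv with P? w
  ... | yes Pw = walk-leaves P? walk Pw ¬Pv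
  ... | no ¬Pw = _ , w , Pu , ¬Pw , u∼w

  ∈-neighbourhood⁺ : ∀ {x y} → x ∼[ G ] y → x ∈ neighbourhood G y
  ∈-neighbourhood⁺ {x} x∼y = lookup⇒[]= x _ (trans (lookup∘tabulate _ x) x∼y)

  ∈-neighbourhood⁻ : ∀ {x y} → x ∈ neighbourhood G y → x ∼[ G ] y
  ∈-neighbourhood⁻ {x} x∈N = trans (sym (lookup∘tabulate _ x)) ([]=⇒lookup x∈N)

Dominated : ∀ {n} → Graph n → Subset n → Fin n → Set
Dominated G D v = v ∈ D ⊎ ∃ λ u → u ∈ D × u ∼[ G ] v

PrivateNeighbour : ∀ {n} → Graph n → Subset n → Fin n → Fin n → Set
PrivateNeighbour G D x v = ∀ u → u ∈ D → u ≡ v ⊎ u ∼[ G ] v → u ≡ x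

module DominationProperties {n} (G : Graph n) where

  private⇒minimal : ∀ {D} → Dominating G D → (∀ x → x ∈ D → ∃ (PrivateNeighbour G D x)) →
                    MinimalDominating G D
  private⇒minimal {D} dom has-private = dom , smaller-not-dominating
    where
    smaller-not-dominating : ∀ D' → D' ⊂ D → ¬ Dominating G D'
    smaller-not-dominating D' (D'⊆D , x , x∈D , x∉D') dom' with has-private x x∈D
    ... | v , v-private with dom' v
    ...   | inj₁ v∈D'             = x∉D' (subst (_∈ D') (v-private v (D'⊆D v∈D') (inj₁ refl)) v∈D')
    ...   | inj₂ (u , u∈D' , u∼v) = x∉D' (subst (_∈ D') (v-private u (D'⊆D u∈D') (inj₂ u∼v)) u∈D')

  dominating<minimal⇒¬wellDominated : ∀ {D M} → Dominating G D → MinimalDominating G M → ∣ D ∣ < ∣ M ∣ →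
                                     ¬ WellDominated G
  dominating<minimal⇒¬wellDominated {D} {M} dom min ∣D∣<∣M∣ (k , (_ , γ≤) , (_ , ≤Γ)) =
    <⇒≱ ∣D∣<∣M∣ (≤-trans (≤Γ M min) (γ≤ D dom))

∀-combine : ∀ {m n} {P : Fin (m * n) → Set} → (∀ i j → P (combine i j)) → ∀ k → P k
∀-combine {m} {n} f k with i , j , refl ← combine-surjective {m} {n} k = f i j

module □-Properties {m n} (G : Graph m) (H : Graph n) where

  □-edge-combine : ∀ g h g' h' → edge (G □ H) (combine g h) (combine g' h') ≡ □-edge G H (g , h) (g' , h')
  □-edge-combine g h g' h' = cong₂ (□-edge G H) (remQuot-combine g h) (remQuot-combine g' h')

  ∼-□ʳ : ∀ g {h h'} → h ∼[ H ] h' → combine g h ∼[ G □ H ] combine g h'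
  ∼-□ʳ g {h} {h'} h∼h' = trans (□-edge-combine g h g h') horizontal
    where
    horizontal : □-edge G H (g , h) (g , h') ≡ true
    horizontal with g ≟ g
    ... | yes _ rewrite h∼h' = refl
    ... | no g≢g = contradiction refl g≢g

  ∼-□ˡ : ∀ g g' h → g ∼[ G ] g' → combine g h ∼[ G □ H ] combine g' h
  ∼-□ˡ g g' h g∼g' = trans (□-edge-combine g h g' h) vertical
    where
    vertical : □-edge G H (g , h) (g' , h) ≡ true
    vertical with h ≟ h
    ... | yes _ rewrite g∼g' = ∨-zeroʳ _
    ... | no h≢h = contradiction refl h≢h

  □-edge⁻ : ∀ {g h g' h'} → □-edge G H (g , h) (g' , h') ≡ true →
            (g ≡ g' × h ∼[ H ] h') ⊎ (h ≡ h' × g ∼[ G ] g')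
  □-edge⁻ {g} {h} {g'} {h'} e with g ≟ g' | h ≟ h' | edge H h h' | edge G g g'
  ... | yes g≡g' | _        | true  | _     = inj₁ (g≡g' , refl)
  ... | _        | yes h≡h' | _     | true  = inj₂ (h≡h' , refl)
  ... | yes _    | no _     | false | _     with () ← e
  ... | no _     | yes _    | _     | false with () ← e
  ... | no _     | no _     | _     | _     with () ← e
  ... | yes _    | yes _    | false | false with () ← e

  □-dominates⁻ : ∀ j h' i h → combine j h' ≡ combine i h ⊎ combine j h' ∼[ G □ H ] combine i h →
                 h' ≡ h ⊎ (j ≡ i × h' ∼[ H ] h)
  □-dominates⁻ j h' i h (inj₁ same) = inj₁ (proj₂ (combine-injective j h' i h same))
  □-dominates⁻ j h' i h (inj₂ adjacent) with □-edge⁻ (trans (sym (□-edge-combine j h' i h)) adjacent)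
  ... | inj₁ same-copy-of-H = inj₂ same-copy-of-H
  ... | inj₂ (h'≡h , _)     = inj₁ h'≡h

layered : ∀ {m n} → (Fin m → Subset n) → Subset (m * n)
layered S = concat (tabulate S)

module _ {m n} (S : Fin m → Subset n) (i : Fin m) (h : Fin n) where

  lookup-layered : lookup (layered S) (combine i h) ≡ lookup (S i) h
  lookup-layered = trans (lookup-concat (tabulate S) i h) (cong (λ s → lookup s h) (lookup∘tabulate S i))

  ∈-layered⁺ : h ∈ S i → combine i h ∈ layered S
  ∈-layered⁺ h∈ = lookup⇒[]= _ _ (trans lookup-layered ([]=⇒lookup h∈))

  ∈-layered⁻ : combine i h ∈ layered S → h ∈ S i
  ∈-layered⁻ ih∈ = lookup⇒[]= _ _ (trans (sym lookup-layered) ([]=⇒lookup ih∈))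

∣layered∣ : ∀ {m n} (S : Fin m → Subset n) → ∣ layered S ∣ ≡ sum (tabulate (∣_∣ ∘ S))
∣layered∣ {zero}  S = refl
∣layered∣ {suc m} S =
  trans (∣p++q∣≡∣p∣+∣q∣ (S zero) (layered (S ∘ suc))) (cong (∣ S zero ∣ +_) (∣layered∣ (S ∘ suc)))

K₃-∼ : ∀ (i j : Fin 3) → i ≢ j → i ∼[ K₃ ] j
K₃-∼ i j i≢j with i ≟ j
... | yes i≡j = contradiction i≡j i≢j
... | no _    = refl

module _ {n} (H : Graph n) where

  open GraphProperties H
  open DominationProperties (K₃ □ H)
  open □-Properties K₃ H

  private
    _∼_ : Fin n → Fin n → Set
    x ∼ y = x ∼[ H ] y

    ⟨_,_⟩ : Fin 3 → Fin n → Fin (3 * n)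
    ⟨ i , h ⟩ = combine i h

    ∀-vertex : {P : Fin (3 * n) → Set} → (∀ i h → P ⟨ i , h ⟩) → ∀ v → P v
    ∀-vertex = ∀-combine

    ∼-vertical : ∀ i j h → i ≢ j → ⟨ i , h ⟩ ∼[ K₃ □ H ] ⟨ j , h ⟩
    ∼-vertical i j h i≢j = ∼-□ˡ i j h (K₃-∼ i j i≢j)

  copy₀ : Fin 3 → Subset n
  copy₀ 0F      = ⊤
  copy₀ (suc _) = ∅

  ∣copy₀∣ : ∣ layered copy₀ ∣ ≡ n
  ∣copy₀∣ = begin
    ∣ layered copy₀ ∣
      ≡⟨ ∣layered∣ copy₀ ⟩
    ∣ ⊤ {n} ∣ + (∣ ∅ {n} ∣ + (∣ ∅ {n} ∣ + 0))
      ≡⟨ cong₂ (λ a b → a + (b + (b + 0))) (∣⊤∣≡n n) (∣⊥∣≡0 n) ⟩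
    n + 0
      ≡⟨ +-identityʳ n ⟩
    n ∎
    where open ≡-Reasoning

  copy₀-dominating : Dominating (K₃ □ H) (layered copy₀)
  copy₀-dominating = ∀-vertex dominated
    where
    dominated : ∀ i h → Dominated (K₃ □ H) (layered copy₀) ⟨ i , h ⟩
    dominated 0F      h = inj₁ (∈-layered⁺ copy₀ 0F h ∈⊤)
    dominated (suc i) h = inj₂ (⟨ 0F , h ⟩ , ∈-layered⁺ copy₀ 0F h ∈⊤ , ∼-vertical 0F (suc i) h λ ())

  copy₀-minimal : MinimalDominating (K₃ □ H) (layered copy₀)
  copy₀-minimal = private⇒minimal copy₀-dominating (∀-vertex private-neighbour)
    where
    private-neighbour : ∀ i h → ⟨ i , h ⟩ ∈ layered copy₀ →
                        ∃ (PrivateNeighbour (K₃ □ H) (layered copy₀) ⟨ i , h ⟩)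
    private-neighbour (suc i) h ih∈ = contradiction (∈-layered⁻ copy₀ (suc i) h ih∈) ∉⊥
    private-neighbour 0F      h _   = ⟨ 1F , h ⟩ , ∀-vertex only-dominator
      where
      only-dominator : ∀ j h' → ⟨ j , h' ⟩ ∈ layered copy₀ →
                       ⟨ j , h' ⟩ ≡ ⟨ 1F , h ⟩ ⊎ ⟨ j , h' ⟩ ∼[ K₃ □ H ] ⟨ 1F , h ⟩ →
                       ⟨ j , h' ⟩ ≡ ⟨ 0F , h ⟩
      only-dominator (suc j) h' jh'∈ _ = contradiction (∈-layered⁻ copy₀ (suc j) h' jh'∈) ∉⊥
      only-dominator 0F      h' _ dominates with □-dominates⁻ 0F h' 1F h dominates
      ... | inj₁ refl     = refl
      ... | inj₂ (() , _)

  Tradeable : Fin n → Subset n → Set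
  Tradeable y R = ∀ r → r ∈ R → r ≢ y → r ∼ y × ∃ λ h → h ∉ R × h ∼ r

  traded : Fin n → Subset n → Fin 3 → Subset n
  traded y R 0F      = ∁ R
  traded y R (suc _) = ⁅ y ⁆

  module _ {y : Fin n} {R : Subset n} where

    traded-dominating : Tradeable y R → Dominating (K₃ □ H) (layered (traded y R))
    traded-dominating tradeable = ∀-vertex dominated
      where
      D : Subset (3 * n)
      D = layered (traded y R)
      dominated : ∀ i h → Dominated (K₃ □ H) D ⟨ i , h ⟩
      dominated 0F h with h ∈? R | h ≟ y
      ... | no h∉R | _ = inj₁ (∈-layered⁺ (traded y R) 0F h (x∉p⇒x∈∁p h∉R))
      ... | yes _  | yes refl =
              inj₂ (⟨ 1F , h ⟩ , ∈-layered⁺ (traded y R) 1F h (x∈⁅x⁆ h) , ∼-vertical 1F 0F h λ ())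
      ... | yes h∈R | no h≢y with tradeable h h∈R h≢y
      ...   | _ , h' , h'∉R , h'∼h =
              inj₂ (⟨ 0F , h' ⟩ , ∈-layered⁺ (traded y R) 0F h' (x∉p⇒x∈∁p h'∉R) , ∼-□ʳ 0F h'∼h)
      dominated (suc i) h with h ≟ y | h ∈? R
      ... | yes refl | _ = inj₁ (∈-layered⁺ (traded y R) (suc i) h (x∈⁅x⁆ h))
      ... | no _ | no h∉R =
              inj₂ (⟨ 0F , h ⟩ , ∈-layered⁺ (traded y R) 0F h (x∉p⇒x∈∁p h∉R) , ∼-vertical 0F (suc i) h λ ())
      ... | no h≢y | yes h∈R =
              inj₂ (⟨ suc i , y ⟩ , ∈-layered⁺ (traded y R) (suc i) y (x∈⁅x⁆ y) ,
                    ∼-□ʳ (suc i) (∼-sym (proj₁ (tradeable h h∈R h≢y))))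

    ∣traded∣<∣copy₀∣ : 3 ≤ ∣ R ∣ → ∣ layered (traded y R) ∣ < ∣ layered copy₀ ∣
    ∣traded∣<∣copy₀∣ 3≤∣R∣ = begin-strict
      ∣ layered (traded y R) ∣
        ≡⟨ ∣layered∣ (traded y R) ⟩
      ∣ ∁ R ∣ + (∣ ⁅ y ⁆ ∣ + (∣ ⁅ y ⁆ ∣ + 0))
        ≡⟨ cong₂ (λ a b → a + (b + (b + 0))) (∣∁p∣≡n∸∣p∣ R) (∣⁅x⁆∣≡1 y) ⟩
      n ∸ ∣ R ∣ + 2
        <⟨ +-monoʳ-< (n ∸ ∣ R ∣) 3≤∣R∣ ⟩
      n ∸ ∣ R ∣ + ∣ R ∣
        ≡⟨ m∸n+n≡m (∣p∣≤n R) ⟩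
      n
        ≡⟨ ∣copy₀∣ ⟨
      ∣ layered copy₀ ∣ ∎
      where open ≤-Reasoning

    tradeable⇒¬wellDominated : 3 ≤ ∣ R ∣ → Tradeable y R → ¬ WellDominated (K₃ □ H)
    tradeable⇒¬wellDominated 3≤∣R∣ tradeable =
      dominating<minimal⇒¬wellDominated (traded-dominating tradeable) copy₀-minimal (∣traded∣<∣copy₀∣ 3≤∣R∣)

  degree≥3⇒¬wellDominated : ∀ {y} → 3 ≤ degree H y → ¬ WellDominated (K₃ □ H)
  degree≥3⇒¬wellDominated {y} 3≤degree = tradeable⇒¬wellDominated {y = y} 3≤degree tradeable
    where
    y∉N : y ∉ neighbourhood H y
    y∉N y∈N = ∼⇒≢ (∈-neighbourhood⁻ y∈N) refl
    tradeable : Tradeable y (neighbourhood H y)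
    tradeable r r∈N _ = ∈-neighbourhood⁻ r∈N , y , y∉N , ∼-sym (∈-neighbourhood⁻ r∈N)

  3≤degree : ∀ {y a b c} → a ∼ y → b ∼ y → c ∼ y → a ≢ b → a ≢ c → b ≢ c → 3 ≤ degree H y
  3≤degree a∼y b∼y c∼y a≢b a≢c b≢c =
    length≤∣p∣ ((a≢b ∷ a≢c ∷ []) ∷ (b≢c ∷ []) ∷ [] ∷ [])
               (∈-neighbourhood⁺ a∼y ∷ ∈-neighbourhood⁺ b∼y ∷ ∈-neighbourhood⁺ c∼y ∷ [])

  record Path₃ : Set where
    constructor path₃
    field
      p q r : Fin n
      p∼q   : p ∼ q
      q∼r   : q ∼ r
      p≢r   : p ≢ r

    vertices : List (Fin n)
    vertices = p ∷ q ∷ r ∷ []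

  record Path₄ : Set where
    constructor path₄
    field
      a b c d : Fin n
      a∼b     : a ∼ b
      b∼c     : b ∼ c
      c∼d     : c ∼ d
      a≢c     : a ≢ c
      a≢d     : a ≢ d
      b≢d     : b ≢ d

    vertices : List (Fin n)
    vertices = a ∷ b ∷ c ∷ d ∷ []

  extended-path₃⇒¬wellDominated : ∀ (P : Path₃) {x z} → let open Path₃ P in
                                  x ∉ₗ vertices → z ∉ₗ vertices → x ∼ p → r ∼ z → ¬ WellDominated (K₃ □ H)
  extended-path₃⇒¬wellDominated (path₃ p q r p∼q q∼r p≢r) {x} {z} x∉ z∉ x∼p r∼z =
    tradeable⇒¬wellDominated {y = q} 3≤∣R∣ tradeable
    where
    R : Subset n
    R = fromList (p ∷ q ∷ r ∷ [])
    3≤∣R∣ : 3 ≤ ∣ R ∣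
    3≤∣R∣ = length≤∣fromList∣ ((∼⇒≢ p∼q ∷ p≢r ∷ []) ∷ (∼⇒≢ q∼r ∷ []) ∷ [] ∷ [])
    tradeable : Tradeable q R
    tradeable _ v∈R v≢q with ∈-fromList⁻ (p ∷ q ∷ r ∷ []) v∈R
    ... | here refl                 = p∼q , x , x∉ ∘ ∈-fromList⁻ _ , x∼p
    ... | there (here refl)         = contradiction refl v≢q
    ... | there (there (here refl)) = ∼-sym q∼r , z , z∉ ∘ ∈-fromList⁻ _ , ∼-sym r∼z

  spanning-path₄⇒¬wellDominated : ∀ (P : Path₄) → let open Path₄ P in
                                  ¬ a ∼ c × ¬ b ∼ d → (∀ h → h ∈ₗ vertices) → ¬ WellDominated (K₃ □ H)
  spanning-path₄⇒¬wellDominated (path₄ a b c d a∼b b∼c c∼d a≢c a≢d b≢d) (a≁c , b≁d) spans =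
    dominating<minimal⇒¬wellDominated copy₀-dominating ends-minimal ∣copy₀∣<∣ends∣
    where
    E : Subset n
    E = fromList (a ∷ d ∷ [])

    D : Subset (3 * n)
    D = layered {3} (const E)

    a∈E : a ∈ E
    a∈E = ∈-fromList⁺ {xs = a ∷ d ∷ []} (here refl)

    d∈E : d ∈ E
    d∈E = ∈-fromList⁺ {xs = a ∷ d ∷ []} (there (here refl))

    ends-dominating : Dominating (K₃ □ H) D
    ends-dominating = ∀-vertex dominated
      where
      dominated : ∀ i h → Dominated (K₃ □ H) D ⟨ i , h ⟩
      dominated i h with spans h
      ... | here refl                         = inj₁ (∈-layered⁺ (const E) i a a∈E)
      ... | there (here refl)         = inj₂ (⟨ i , a ⟩ , ∈-layered⁺ (const E) i a a∈E , ∼-□ʳ i a∼b)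
      ... | there (there (here refl)) = inj₂ (⟨ i , d ⟩ , ∈-layered⁺ (const E) i d d∈E , ∼-□ʳ i (∼-sym c∼d))
      ... | there (there (there (here refl))) = inj₁ (∈-layered⁺ (const E) i d d∈E)

    end-private : ∀ i {end next other} → (∀ {h} → h ∈ₗ a ∷ d ∷ [] → h ≡ end ⊎ h ≡ other) →
                  end ∼ next → other ≢ next → ¬ other ∼ next → ∃ (PrivateNeighbour (K₃ □ H) D ⟨ i , end ⟩)
    end-private i {end} {next} {other} ends end∼next other≢next other≁next =
      ⟨ i , next ⟩ , ∀-vertex only-dominator
      where
      only-dominator : ∀ j h → ⟨ j , h ⟩ ∈ D → ⟨ j , h ⟩ ≡ ⟨ i , next ⟩ ⊎ ⟨ j , h ⟩ ∼[ K₃ □ H ] ⟨ i , next ⟩ →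
                       ⟨ j , h ⟩ ≡ ⟨ i , end ⟩
      only-dominator j h jh∈D dominates
        with ends (∈-fromList⁻ (a ∷ d ∷ []) (∈-layered⁻ (const E) j h jh∈D))
           | □-dominates⁻ j h i next dominates
      ... | inj₁ refl | inj₁ end≡next          = contradiction end≡next (∼⇒≢ end∼next)
      ... | inj₁ refl | inj₂ (refl , _)       = refl
      ... | inj₂ refl | inj₁ other≡next        = contradiction other≡next other≢next
      ... | inj₂ refl | inj₂ (_ , other∼next) = contradiction other∼next other≁next

    ends-minimal : MinimalDominating (K₃ □ H) D
    ends-minimal = private⇒minimal ends-dominating (∀-vertex private-neighbour)
      where
      private-neighbour : ∀ i h → ⟨ i , h ⟩ ∈ D → ∃ (PrivateNeighbour (K₃ □ H) D ⟨ i , h ⟩)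
      private-neighbour i h ih∈D with ∈-fromList⁻ (a ∷ d ∷ []) (∈-layered⁻ (const E) i h ih∈D)
      ... | here refl =
        end-private i (λ { (here refl) → inj₁ refl ; (there (here refl)) → inj₂ refl })
                    a∼b (b≢d ∘ sym) (b≁d ∘ ∼-sym)
      ... | there (here refl) =
        end-private i (λ { (here refl) → inj₂ refl ; (there (here refl)) → inj₁ refl })
                    (∼-sym c∼d) a≢c a≁c

    n≤4 : n ≤ 4
    n≤4 = begin
      n                                     ≡⟨ ∣⊤∣≡n n ⟨
      ∣ ⊤ {n} ∣                             ≤⟨ p⊆q⇒∣p∣≤∣q∣ {p = ⊤} (λ {h} _ → ∈-fromList⁺ (spans h)) ⟩
      ∣ fromList (a ∷ b ∷ c ∷ d ∷ []) ∣     ≤⟨ ∣fromList∣≤length (a ∷ b ∷ c ∷ d ∷ []) ⟩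
      4                                     ∎
      where open ≤-Reasoning

    ∣copy₀∣<∣ends∣ : ∣ layered copy₀ ∣ < ∣ D ∣
    ∣copy₀∣<∣ends∣ = begin-strict
      ∣ layered copy₀ ∣              ≡⟨ ∣copy₀∣ ⟩
      n                              ≤⟨ n≤4 ⟩
      4                              <⟨ n≤1+n 5 ⟩
      2 + (2 + (2 + 0))              ≤⟨ +-mono-≤ 2≤∣E∣ (+-mono-≤ 2≤∣E∣ (+-mono-≤ 2≤∣E∣ ≤-refl)) ⟩
      ∣ E ∣ + (∣ E ∣ + (∣ E ∣ + 0))  ≡⟨ ∣layered∣ {3} (const E) ⟨
      ∣ D ∣                          ∎
      where
      open ≤-Reasoning
      2≤∣E∣ : 2 ≤ ∣ E ∣
      2≤∣E∣ = length≤∣fromList∣ ((a≢d ∷ []) ∷ [] ∷ [])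

  module PathGrowth (connected : Connected H) (n≥4 : n ≥ 4) where

    open import Data.List.Membership.DecPropositional (_≟_ {n}) using () renaming (_∈?_ to _∈ₗ?_)

    leaving-edge : ∀ xs {x} → x ∈ₗ xs → length xs < 4 → ∃₂ λ s t → s ∈ₗ xs × t ∉ₗ xs × s ∼ t
    leaving-edge xs {x} x∈xs short
      with v , v∉ ← ∃∉ (fromList xs) (≤-<-trans (∣fromList∣≤length xs) (<-≤-trans short n≥4))
      = walk-leaves (_∈ₗ? xs) (connected x v) x∈xs (v∉ ∘ ∈-fromList⁺)

    some-vertex : Fin n
    some-vertex = fromℕ< (<-≤-trans (s≤s z≤n) n≥4)

    some-path₃ : Path₃
    some-path₃ with u , v , _ , _ , u∼v ← leaving-edge (some-vertex ∷ []) (here refl) (s≤s (s≤s z≤n))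
                  | leaving-edge (u ∷ v ∷ []) (here refl) (s≤s (s≤s (s≤s z≤n)))
    ... | _ , t , here refl         , t∉ , u∼t = path₃ t u v (∼-sym u∼t) u∼v (t∉ ∘ there ∘ here)
    ... | _ , t , there (here refl) , t∉ , v∼t = path₃ u v t u∼v v∼t (t∉ ∘ here ∘ sym)

    module _ (degree<3 : ∀ y → degree H y < 3) where

      no-three-neighbours : ∀ {y a b c} → a ∼ y → b ∼ y → c ∼ y → a ≢ b → a ≢ c → b ≢ c → ⊥
      no-three-neighbours {y} a∼y b∼y c∼y a≢b a≢c b≢c = <⇒≱ (degree<3 y) (3≤degree a∼y b∼y c∼y a≢b a≢c b≢c)

      path₃⇒path₄ : Path₃ → Path₄
      path₃⇒path₄ (path₃ p q r p∼q q∼r p≢r) with leaving-edge (p ∷ q ∷ r ∷ []) (here refl) ≤-refl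
      ... | _ , t , here refl , t∉ , p∼t =
        path₄ t p q r (∼-sym p∼t) p∼q q∼r (t∉ ∘ there ∘ here) (t∉ ∘ there ∘ there ∘ here) p≢r
      ... | _ , t , there (here refl) , t∉ , q∼t =
        ⊥-elim (no-three-neighbours p∼q (∼-sym q∼r) (∼-sym q∼t) p≢r (t∉ ∘ here ∘ sym)
                                    (t∉ ∘ there ∘ there ∘ here ∘ sym))
      ... | _ , t , there (there (here refl)) , t∉ , r∼t =
        path₄ p q r t p∼q q∼r r∼t p≢r (t∉ ∘ here ∘ sym) (t∉ ∘ there ∘ here ∘ sym)

      path₄-induced : (P : Path₄) → let open Path₄ P in ¬ a ∼ c × ¬ b ∼ d
      path₄-induced (path₄ a b c d a∼b b∼c c∼d a≢c a≢d b≢d) =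
        (λ a∼c → no-three-neighbours b∼c (∼-sym c∼d) a∼c b≢d (∼⇒≢ a∼b ∘ sym) (a≢d ∘ sym)) ,
        (λ b∼d → no-three-neighbours a∼b (∼-sym b∼c) (∼-sym b∼d) a≢c a≢d (∼⇒≢ c∼d))

      leaving-path₄⇒¬wellDominated : ∀ (P : Path₄) {s t} → let open Path₄ P in
                                     s ∈ₗ vertices → t ∉ₗ vertices → s ∼ t → ¬ WellDominated (K₃ □ H)
      leaving-path₄⇒¬wellDominated (path₄ a b c d a∼b b∼c c∼d a≢c a≢d b≢d) {t = t} s∈ t∉ s∼t with s∈
      ... | here refl =
        extended-path₃⇒¬wellDominated (path₃ a b c a∼b b∼c a≢c) (t∉ ∘ ∈-++⁺ˡ {ys = d ∷ []})
          (All¬⇒¬Any ((a≢d ∘ sym) ∷ (b≢d ∘ sym) ∷ (∼⇒≢ c∼d ∘ sym) ∷ [])) (∼-sym s∼t) c∼d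
      ... | there (here refl) =
        ⊥-elim (no-three-neighbours a∼b (∼-sym b∼c) (∼-sym s∼t) a≢c (t∉ ∘ here ∘ sym)
                                    (t∉ ∘ there ∘ there ∘ here ∘ sym))
      ... | there (there (here refl)) =
        ⊥-elim (no-three-neighbours b∼c (∼-sym c∼d) (∼-sym s∼t) b≢d (t∉ ∘ there ∘ here ∘ sym)
                                    (t∉ ∘ there ∘ there ∘ there ∘ here ∘ sym))
      ... | there (there (there (here refl))) =
        extended-path₃⇒¬wellDominated (path₃ b c d b∼c c∼d b≢d)
          (All¬⇒¬Any (∼⇒≢ a∼b ∷ a≢c ∷ a≢d ∷ [])) (t∉ ∘ there) a∼b s∼t

      path₄⇒¬wellDominated : Path₄ → ¬ WellDominated (K₃ □ H)
      path₄⇒¬wellDominated P with all? (_∈ₗ? Path₄.vertices P)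
      ... | yes spans = spanning-path₄⇒¬wellDominated P (path₄-induced P) spans
      ... | no ¬spans
        with v , v∉ ← ¬∀⟶∃¬ n _ (_∈ₗ? Path₄.vertices P) ¬spans
        with _ , _ , s∈ , t∉ , s∼t ←
               walk-leaves (_∈ₗ? Path₄.vertices P) (connected (Path₄.a P) v) (here refl) v∉
        = leaving-path₄⇒¬wellDominated P s∈ t∉ s∼t

proposition7 : ∀ {n} (H : Graph n) → n ≥ 4 → Connected H → ¬ WellDominated (K₃ □ H)
proposition7 H n≥4 connected with any? (λ y → 3 ≤? degree H y)
... | yes (_ , 3≤degree) = degree≥3⇒¬wellDominated H 3≤degree
... | no no-degree≥3     = path₄⇒¬wellDominated degree<3 (path₃⇒path₄ degree<3 some-path₃)
  where
  open PathGrowth H connected n≥4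
  degree<3 : ∀ y → degree H y < 3
  degree<3 y = ≰⇒> (no-degree≥3 ∘ (y ,_))
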